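{- Let $G=(G,G^{W},\Vdash^{G},\ell^{G})$ be a graph with complementarity. Then $G$ is modular if and only if the relation $\Vdash^{G}$, viewed as a relation between $G^{\smile}$ (a reflexive graph over $\Sigma$ via $\Downarrow$) and $G^{W}$ (a reflexive graph over $\Sigma$ via $\ell^{G}$), is a strong bisimulation over $\Sigma$.
   Context: Reflexive graphs have vertices, edges, source/target maps and identity edges $\mathit{id}_x\colon x\to x$; morphisms preserve them; products, pullbacks, subgraphs are componentwise. A relation between reflexive graphs is a subgraph of their product; it is partially functional if each vertex/edge is related to at most one; its domain is the subgraph of related elements. $\Sigma$ is the reflexive graph with one vertex and edges $\mathit{id}$ and $\heartsuit$. A graph with complementarity is $(G,G^{W},\Vdash^{G},\ell^{G})$: $G$ a reflexive graph, $G^{W}$ a subgraph, $\Vdash^{G}\colon G\times G\nrightarrow G^{W}$ a relation (written $(x,y)\Vdash^{G} z$), $\ell^{G}\colon G^{W}\to\Sigma$ a morphism, such that the composite relation $G\times G\nrightarrow G^{W}\to\Sigma$ is partially functional and symmetric. $G^{\smile}\subseteq G\times G$ is the domain of $\Vdash^{G}$; write $x\smile y$ for $(x,y)\in G^{\smile}$, and $(x\Downarrow y)\in\Sigma$ for the image of $(x,y)\in G^{\smile}$ under the composite, which makes $G^{\smile}$ a graph over $\Sigma$. $G$ is modular iff for all vertices with $(x,y)\Vdash^{G} z$: (1) for every edge $e\colon z'\to z$ of $G^{W}$ there are edges $e_x\colon x'\to x$, $e_y\colon y'\to y$ with $(e_x,e_y)\Vdash^{G} e$; and (2) for all edges $e_x\colon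 x'\to x$, $e_y\colon y'\to y$ with $e_x\smile e_y$ there is an edge $e\colon z'\to z$ with $(e_x,e_y)\Vdash^{G} e$. A morphism $f\colon K\to L$ of reflexive graphs is a graph fibration if for every vertex $x$ of $K$ and edge $e'\colon y\to f(x)$ of $L$ there is an edge $e\colon x'\to x$ of $K$ with $f(e)=e'$. Given graphs $p\colon K\to B$, $q\colon L\to B$ over $B$, a strong bisimulation over $B$ is a subgraph $R$ of the pullback $K\times_B L$ whose two projections $R\to K$ and $R\to L$ are graph fibrations. -}

module Defs where

open import Level using (Level; suc)
open import Data.Product using (Σ; Σ-syntax; ∃; ∃-syntax; _×_; _,_; proj₁; proj₂)
open import Data.Unit.Polymorphic using (⊤; tt)
open import Data.Irrelevant using (Irrelevant; [_]; irrelevant)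
import Data.Empty.Irrelevant as IrrEmpty
open import Relation.Nullary using (Dec; yes; no; ¬_)
open import Relation.Binary.PropositionalEquality
  using (_≡_; refl; sym; trans; cong; cong₂; subst)

private variable a : Level

record RGraph (a : Level) : Set (suc a) where
  field
    V      : Set a
    E      : Set a
    src    : E → V
    tgt    : E → V
    rid    : V → E
    src-id : ∀ x → src (rid x) ≡ x
    tgt-id : ∀ x → tgt (rid x) ≡ x
open RGraph public

record Hom (G H : RGraph a) : Set a where
  field
    fV       : V G → V H
    fE       : E G → E H
    pres-src : ∀ e → src H (fE e) ≡ fV (src G e)
    pres-tgt : ∀ e → tgt H (fE e) ≡ fV (tgt G e)
    pres-id  : ∀ x → fE (rid G x) ≡ rid H (fV x)
open Hom public

_⊗_ : RGraph a → RGraph a → RGraph a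
G ⊗ H = record
  { V = V G × V H ; E = E G × E H
  ; src = λ { (e , e') → src G e , src H e' }
  ; tgt = λ { (e , e') → tgt G e , tgt H e' }
  ; rid = λ { (x , y) → rid G x , rid H y }
  ; src-id = λ { (x , y) → cong₂ _,_ (src-id G x) (src-id H y) }
  ; tgt-id = λ { (x , y) → cong₂ _,_ (tgt-id G x) (tgt-id H y) } }

IsProp : Set a → Set a
IsProp A = (p q : A) → p ≡ q

record Subgraph (G : RGraph a) : Set (suc a) where
  field
    SV     : V G → Set a
    SE     : E G → Set a
    SV-prop : ∀ {x} → IsProp (SV x)
    SE-prop : ∀ {e} → IsProp (SE e)
    src-closed : ∀ {e} → SE e → SV (src G e)
    tgt-closed : ∀ {e} → SE e → SV (tgt G e)
    id-closed  : ∀ {x} → SV x → SE (rid G x)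
open Subgraph public

private
  Σ-≡ : {A : Set a} {P : A → Set a} → (∀ {x} → IsProp (P x)) →
        {x y : A} {p : P x} {q : P y} → x ≡ y → (x , p) ≡ (y , q)
  Σ-≡ prop {p = p} {q} refl = cong (_ ,_) (prop p q)

⟦_⟧ : {G : RGraph a} → Subgraph G → RGraph a
⟦_⟧ {G = G} S = record
  { V = Σ (V G) (SV S) ; E = Σ (E G) (SE S)
  ; src = λ { (e , p) → src G e , src-closed S p }
  ; tgt = λ { (e , p) → tgt G e , tgt-closed S p }
  ; rid = λ { (x , p) → rid G x , id-closed S p }
  ; src-id = λ { (x , p) → Σ-≡ (SV-prop S) (src-id G x) }
  ; tgt-id = λ { (x , p) → Σ-≡ (SV-prop S) (tgt-id G x) } }

-- A relation between K and L is a subgraph of K ⊗ L; its projections.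
π₁ : {K L : RGraph a} (R : Subgraph (K ⊗ L)) → Hom ⟦ R ⟧ K
π₁ R = record { fV = λ r → proj₁ (proj₁ r) ; fE = λ r → proj₁ (proj₁ r)
              ; pres-src = λ _ → refl ; pres-tgt = λ _ → refl ; pres-id = λ _ → refl }

π₂ : {K L : RGraph a} (R : Subgraph (K ⊗ L)) → Hom ⟦ R ⟧ L
π₂ R = record { fV = λ r → proj₂ (proj₁ r) ; fE = λ r → proj₂ (proj₁ r)
              ; pres-src = λ _ → refl ; pres-tgt = λ _ → refl ; pres-id = λ _ → refl }

data ΣEdge {a : Level} : Set a where
  idΣ : ΣEdge
  ♡   : ΣEdge

ΣG : RGraph a
ΣG = record { V = ⊤ ; E = ΣEdge ; src = λ _ → tt ; tgt = λ _ → tt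
            ; rid = λ _ → idΣ ; src-id = λ _ → refl ; tgt-id = λ _ → refl }

_≟Σ_ : (s t : ΣEdge {a}) → Dec (s ≡ t)
idΣ ≟Σ idΣ = yes refl
idΣ ≟Σ ♡   = no λ ()
♡   ≟Σ idΣ = no λ ()
♡   ≟Σ ♡   = yes refl

IsGraphFibration : {K L : RGraph a} → Hom K L → Set a
IsGraphFibration {K = K} {L} f =
  ∀ (x : V K) (e' : E L) → tgt L e' ≡ fV f x →
  Σ[ e ∈ E K ] (tgt K e ≡ x × fE f e ≡ e')

record Over (B : RGraph a) : Set (suc a) where
  constructor over
  field
    carrier : RGraph a
    proj    : Hom carrier B
open Over public

-- R ⊆ K ⊗ L is a strong bisimulation over B: R is a subgraph of the
-- pullback K ×_B L (i.e. it is contained in it) and both projections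
-- R → K, R → L are graph fibrations.
record IsStrongBisimulation {B : RGraph a} (K L : Over B)
         (R : Subgraph (carrier K ⊗ carrier L)) : Set a where
  field
    in-pullbackV : ∀ {k l} → SV R (k , l) → fV (proj K) k ≡ fV (proj L) l
    in-pullbackE : ∀ {k l} → SE R (k , l) → fE (proj K) k ≡ fE (proj L) l
    fib₁ : IsGraphFibration (π₁ R)
    fib₂ : IsGraphFibration (π₂ R)

-- composite relation  A ⇸ B → C  of a relation R ⊆ A ⊗ B with f : B → C
CompV : {A B C : RGraph a} → Subgraph (A ⊗ B) → Hom B C → V A → V C → Set a
CompV {B = B} R f x c = Σ[ z ∈ V B ] (SV R (x , z) × fV f z ≡ c)

CompE : {A B C : RGraph a} → Subgraph (A ⊗ B) → Hom B C → E A → E C → Set a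
CompE {B = B} R f x c = Σ[ z ∈ E B ] (SE R (x , z) × fE f z ≡ c)

swap : {X : Set a} → X × X → X × X
swap (x , y) = y , x

record GraphWithComplementarity (a : Level) : Set (suc a) where
  field
    G  : RGraph a
    GW : Subgraph G
    ⊩  : Subgraph ((G ⊗ G) ⊗ ⟦ GW ⟧)
    ℓ  : Hom ⟦ GW ⟧ ΣG
    pfunV : ∀ {p s t} → CompV ⊩ ℓ p s → CompV ⊩ ℓ p t → s ≡ t
    pfunE : ∀ {p s t} → CompE ⊩ ℓ p s → CompE ⊩ ℓ p t → s ≡ t
    symV  : ∀ {p s} → CompV ⊩ ℓ p s → CompV ⊩ ℓ (swap p) s
    symE  : ∀ {p s} → CompE ⊩ ℓ p s → CompE ⊩ ℓ (swap p) s

module _ (GC : GraphWithComplementarity a) where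
  open GraphWithComplementarity GC

  private
    propV : ∀ {p} → IsProp (Σ[ t ∈ V (ΣG {a}) ] Irrelevant (CompV ⊩ ℓ p t))
    propV (tt , [ _ ]) (tt , [ _ ]) = refl

    propE : ∀ {p} → IsProp (Σ[ s ∈ E (ΣG {a}) ] Irrelevant (CompE ⊩ ℓ p s))
    propE (s , [ u ]) (t , [ v ]) with s ≟Σ t
    ... | yes refl = refl
    ... | no s≢t = IrrEmpty.⊥-elim (s≢t (pfunE u v))

  -- G^⌣ : the domain of ⊩ (a subgraph of G × G).  Membership of (x , y)
  -- records the (unique) value (x ⇓ y) in Σ together with an
  -- (irrelevant, i.e. propositionally truncated) witness of relatedness.
  Dom : Subgraph (G ⊗ G)
  Dom = record
    { SV = λ p → Σ[ t ∈ V (ΣG {a}) ] Irrelevant (CompV ⊩ ℓ p t)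
    ; SE = λ e → Σ[ s ∈ E (ΣG {a}) ] Irrelevant (CompE ⊩ ℓ e s)
    ; SV-prop = propV ; SE-prop = propE
    ; src-closed = λ { (s , [ w ]) → tt , [ srcw w ] }
    ; tgt-closed = λ { (s , [ w ]) → tt , [ tgtw w ] }
    ; id-closed  = λ { (t , [ w ]) → idΣ , [ idw w ] } }
    where
    srcw : ∀ {e s} → CompE ⊩ ℓ e s → CompV ⊩ ℓ (src (G ⊗ G) e) tt
    srcw (z , r , _) = src ⟦ GW ⟧ z , src-closed ⊩ r , refl
    tgtw : ∀ {e s} → CompE ⊩ ℓ e s → CompV ⊩ ℓ (tgt (G ⊗ G) e) tt
    tgtw (z , r , _) = tgt ⟦ GW ⟧ z , tgt-closed ⊩ r , refl
    idw : ∀ {p t} → CompV ⊩ ℓ p t → CompE ⊩ ℓ (rid (G ⊗ G) p) idΣ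
    idw (z , r , _) = rid ⟦ GW ⟧ z , id-closed ⊩ r , pres-id ℓ z

  _⌣_ : E G → E G → Set a
  ex ⌣ ey = SE Dom (ex , ey)

  ⇓ : Hom ⟦ Dom ⟧ ΣG
  ⇓ = record { fV = λ p → proj₁ (proj₂ p) ; fE = λ e → proj₁ (proj₂ e)
             ; pres-src = λ _ → refl ; pres-tgt = λ _ → refl ; pres-id = λ _ → refl }

  ⊩-rel : Subgraph (⟦ Dom ⟧ ⊗ ⟦ GW ⟧)
  ⊩-rel = record
    { SV = λ { ((p , _) , z) → SV ⊩ (p , z) }
    ; SE = λ { ((e , _) , z) → SE ⊩ (e , z) }
    ; SV-prop = SV-prop ⊩ ; SE-prop = SE-prop ⊩
    ; src-closed = src-closed ⊩ ; tgt-closed = tgt-closed ⊩ ; id-closed = id-closed ⊩ }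

  IsModular : Set a
  IsModular =
    ∀ (x y : V G) (z : V ⟦ GW ⟧) → SV ⊩ ((x , y) , z) →
      (∀ (e : E ⟦ GW ⟧) → tgt ⟦ GW ⟧ e ≡ z →
         Σ[ ex ∈ E G ] Σ[ ey ∈ E G ]
           (tgt G ex ≡ x × tgt G ey ≡ y × SE ⊩ ((ex , ey) , e)))
    × (∀ (ex ey : E G) → tgt G ex ≡ x → tgt G ey ≡ y → ex ⌣ ey →
         Σ[ e ∈ E ⟦ GW ⟧ ] (tgt ⟦ GW ⟧ e ≡ z × SE ⊩ ((ex , ey) , e)))

-- A vertex of ⊩ (as a relation G^⌣ ⇸ G^W) is exactly a related triple
-- (x , y) ⊩ z.  The proof is pointwise in such a vertex v:
--   * clause (1) of modularity at v  ⇔  π₂ : ⊩ → G^W lifts edges into v,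
--   * clause (2) of modularity at v  ⇔  π₁ : ⊩ → G^⌣ lifts edges into v.
-- Both equivalences only need that a target equation in ⊩ is determined
-- by its G-components, since all membership predicates are propositions.
-- Containment of ⊩ in the pullback over Σ is independent of modularity:
-- on vertices it is trivial (Σ has one vertex), on edges it is partial
-- functionality of the composite G × G ⇸ G^W → Σ.  The theorem is then the
-- conjunction of the two pointwise equivalences over all vertices.
module Submission where

open import Defs
open import Level using (Level)
open import Function using (_∘_)
open import Function.Bundles using (_⇔_; mk⇔; module Equivalence)
open import Data.Product using (Σ-syntax; _×_; _,_; proj₁; proj₂)
open import Data.Product.Properties using (Σ-≡,≡→≡)
open import Data.Unit.Polymorphic using (tt)
open import Data.Irrelevant using ([_])
import Data.Empty.Irrelevant as IrrEmpty
open import Relation.Nullary using (yes; no)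
open import Relation.Binary.PropositionalEquality using (_≡_; refl; cong; cong₂)

subset-≡ : {a : Level} {A : Set a} {P : A → Set a} → (∀ {x} → IsProp (P x)) →
           {x y : A} {p : P x} {q : P y} → x ≡ y → (x , p) ≡ (y , q)
subset-≡ prop {p = p} eq = Σ-≡,≡→≡ (eq , prop _ _)

-- The lifting property of a graph fibration at one vertex x of K:
-- IsGraphFibration f is, by definition, ∀ x → LiftsAt f x.
LiftsAt : {a : Level} {K L : RGraph a} → Hom K L → V K → Set a
LiftsAt {K = K} {L} f x =
  ∀ (e' : E L) → tgt L e' ≡ fV f x → Σ[ e ∈ E K ] (tgt K e ≡ x × fE f e ≡ e')

module Modularity {a : Level} (GC : GraphWithComplementarity a) where
  open GraphWithComplementarity GC

  R : Subgraph (⟦ Dom GC ⟧ ⊗ ⟦ GW ⟧)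
  R = ⊩-rel GC

  IsBisimulation : Set a
  IsBisimulation = IsStrongBisimulation (over ⟦ Dom GC ⟧ (⇓ GC)) (over ⟦ GW ⟧ ℓ) R

  EdgesSplit : V G × V G → V ⟦ GW ⟧ → Set a
  EdgesSplit xy z =
    ∀ (e : E ⟦ GW ⟧) → tgt ⟦ GW ⟧ e ≡ z →
      Σ[ ex ∈ E G ] Σ[ ey ∈ E G ]
        (tgt G ex ≡ proj₁ xy × tgt G ey ≡ proj₂ xy × SE ⊩ ((ex , ey) , e))

  EdgesJoin : V G × V G → V ⟦ GW ⟧ → Set a
  EdgesJoin xy z =
    ∀ (ex ey : E G) → tgt G ex ≡ proj₁ xy → tgt G ey ≡ proj₂ xy → _⌣_ GC ex ey →
      Σ[ e ∈ E ⟦ GW ⟧ ] (tgt ⟦ GW ⟧ e ≡ z × SE ⊩ ((ex , ey) , e))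

  pairV : V ⟦ R ⟧ → V G × V G
  pairV v = proj₁ (proj₁ (proj₁ v))

  valueV : V ⟦ R ⟧ → V ⟦ GW ⟧
  valueV v = proj₂ (proj₁ v)

  pairE : E ⟦ R ⟧ → E G × E G
  pairE ε = proj₁ (proj₁ (proj₁ ε))

  valueE : E ⟦ R ⟧ → E ⟦ GW ⟧
  valueE ε = proj₂ (proj₁ ε)

  relVertex : ∀ {xy z} → SV ⊩ (xy , z) → V ⟦ R ⟧
  relVertex {xy} {z} r = ((xy , (tt , [ z , r , refl ])) , z) , r

  relEdge : ∀ {exy e} → SE ⊩ (exy , e) → E ⟦ R ⟧
  relEdge {exy} {e} r = ((exy , (fE ℓ e , [ e , r , refl ])) , e) , r

  tgt-≡ : (ε : E ⟦ R ⟧) (v : V ⟦ R ⟧) →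
          tgt (G ⊗ G) (pairE ε) ≡ pairV v → tgt ⟦ GW ⟧ (valueE ε) ≡ valueV v →
          tgt ⟦ R ⟧ ε ≡ v
  tgt-≡ _ _ pair≡ value≡ =
    subset-≡ (SV-prop ⊩) (cong₂ _,_ (subset-≡ (SV-prop (Dom GC)) pair≡) value≡)

  -- Related edges have the same label in Σ, by partial functionality of
  -- G × G ⇸ G^W → Σ; this puts the edges of ⊩ in the pullback over Σ.
  labels-agree : (k : E ⟦ Dom GC ⟧) (l : E ⟦ GW ⟧) → SE R (k , l) →
                 fE (⇓ GC) k ≡ fE ℓ l
  labels-agree (_ , s , [ w ]) l r with s ≟Σ fE ℓ l
  ... | yes s≡ℓl = s≡ℓl
  ... | no s≢ℓl = IrrEmpty.⊥-elim (s≢ℓl (pfunE w (l , r , refl)))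

  split⇔lift₂ : (v : V ⟦ R ⟧) → EdgesSplit (pairV v) (valueV v) ⇔ LiftsAt (π₂ R) v
  split⇔lift₂ v = mk⇔ split⇒lift lift⇒split
    where
    split⇒lift : EdgesSplit (pairV v) (valueV v) → LiftsAt (π₂ R) v
    split⇒lift split e e↦z with split e e↦z
    ... | ex , ey , ex↦x , ey↦y , r =
      relEdge r , tgt-≡ (relEdge r) v (cong₂ _,_ ex↦x ey↦y) e↦z , refl

    lift⇒split : LiftsAt (π₂ R) v → EdgesSplit (pairV v) (valueV v)
    lift⇒split lift e e↦z with lift e e↦z
    ... | ε , ε↦v , refl =
      proj₁ (pairE ε) , proj₂ (pairE ε) ,
      cong (proj₁ ∘ pairV) ε↦v , cong (proj₂ ∘ pairV) ε↦v , proj₂ ε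

  join⇔lift₁ : (v : V ⟦ R ⟧) → EdgesJoin (pairV v) (valueV v) ⇔ LiftsAt (π₁ R) v
  join⇔lift₁ v = mk⇔ join⇒lift lift⇒join
    where
    join⇒lift : EdgesJoin (pairV v) (valueV v) → LiftsAt (π₁ R) v
    join⇒lift join (exy , ex⌣ey) exy↦xy
      with join (proj₁ exy) (proj₂ exy) (cong (proj₁ ∘ proj₁) exy↦xy)
                (cong (proj₂ ∘ proj₁) exy↦xy) ex⌣ey
    ... | e , e↦z , r = ε , tgt-≡ ε v (cong proj₁ exy↦xy) e↦z , refl
      where
      ε : E ⟦ R ⟧
      ε = ((exy , ex⌣ey) , e) , r

    lift⇒join : LiftsAt (π₁ R) v → EdgesJoin (pairV v) (valueV v)
    lift⇒join lift ex ey ex↦x ey↦y ex⌣ey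
      with lift ((ex , ey) , ex⌣ey)
                (subset-≡ (SV-prop (Dom GC)) (cong₂ _,_ ex↦x ey↦y))
    ... | (((_ , _) , e) , r) , ε↦v , refl = e , cong valueV ε↦v , r

proposition6p17 : {a : Level} (GC : GraphWithComplementarity a) →
    IsModular GC ⇔
    IsStrongBisimulation (over ⟦ Dom GC ⟧ (⇓ GC))
    (over ⟦ GraphWithComplementarity.GW GC ⟧ (GraphWithComplementarity.ℓ GC))
    (⊩-rel GC)
proposition6p17 GC = mk⇔ modular⇒bisimulation bisimulation⇒modular
  where
  open Modularity GC
  open Equivalence using (to; from)

  modular⇒bisimulation : IsModular GC → IsBisimulation
  modular⇒bisimulation modular = record
    { in-pullbackV = λ _ → refl
    ; in-pullbackE = λ {k} {l} → labels-agree k l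
    ; fib₁ = λ v → to (join⇔lift₁ v) (proj₂ (clauses v))
    ; fib₂ = λ v → to (split⇔lift₂ v) (proj₁ (clauses v)) }
    where
    clauses : (v : V ⟦ R ⟧) → EdgesSplit (pairV v) (valueV v) × EdgesJoin (pairV v) (valueV v)
    clauses v = modular _ _ (valueV v) (proj₂ v)

  bisimulation⇒modular : IsBisimulation → IsModular GC
  bisimulation⇒modular bisim x y z r =
    from (split⇔lift₂ v) (fib₂ v) , from (join⇔lift₁ v) (fib₁ v)
    where
    open IsStrongBisimulation bisim
    v : V ⟦ R ⟧
    v = relVertex r
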